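{- Let $\pi$ be a $k$-permutation, $P_\pi(\alpha,\beta)$ its gradient polynomial, and $i,j\in\mathbb{N}_0$. If $i\le k-2$ and $j\le k-2$, then $$c_{i,j}(P_\pi)=\frac{k!\,(-1)^{i+j}}{i!\,j!\,(k-i-2)!\,(k-j-2)!}\left(\mathbf{b}_{i+2}^T A_\pi\,\mathbf{b}_{j+2}\right),$$ and otherwise $c_{i,j}(P_\pi)=0$.
   Context: $[k]=\{1,\dots,k\}$; a $k$-permutation is a bijection $\pi:[k]\to[k]$. Its permutation matrix $A_\pi\in\mathbb{R}^{k\times k}$ has $(A_\pi)_{i,j}=1$ if $\pi(i)=j$ and $0$ otherwise. The gradient polynomial of $\pi$ is $P_\pi(\alpha,\beta)=k!\sum_{m\in[k]}\left(\frac{k-m}{1-\alpha}-\frac{m-1}{\alpha}\right)\left(\frac{k-\pi(m)}{1-\beta}-\frac{\pi(m)-1}{\beta}\right)\frac{\alpha^{m-1}(1-\alpha)^{k-m}\beta^{\pi(m)-1}(1-\beta)^{k-\pi(m)}}{(m-1)!(k-m)!(\pi(m)-1)!(k-\pi(m))!}$, a polynomial in $\alpha,\beta$. For a polynomial $P$, $c_{i,j}(P)$ is the coefficient of $\alpha^i\beta^j$ in $P$. For $a\in[k]$, $\mathbf{b}_a=\mathbf{b}^k_a\in\mathbb{R}^k$ is the vector with $i$-th entry $(-1)^{i-1}\binom{a-1}{i-1}$ for $1\le i\le a$ and $0$ for $i>a$. -}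

module Defs where

open import Data.Nat as ℕ using (ℕ; zero; suc; _∸_; _!; _<?_)
open import Data.Nat.Properties using (_!≢0)
open import Data.Nat.Combinatorics using (_C_)
open import Data.Integer as ℤ using (+_)
open import Data.Rational using (ℚ; 0ℚ; 1ℚ; _+_; _*_; _-_; -_; _/_)
open import Data.Fin using (Fin; toℕ)
import Data.Fin as Fin
open import Data.Fin.Permutation using (Permutation′; _⟨$⟩ʳ_)
open import Relation.Nullary using (yes; no)
open import Data.Fin using (_≟_)

ℕ→ℚ : ℕ → ℚ
ℕ→ℚ n = (+ n) / 1

invFact : ℕ → ℚ
invFact n = (+ 1) / (n !)
  where instance _ = n !≢0

neg1^ : ℕ → ℚ
neg1^ zero    = 1ℚ
neg1^ (suc n) = - neg1^ n

sumTo : ℕ → (ℕ → ℚ) → ℚ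
sumTo zero    f = f 0
sumTo (suc n) f = sumTo n f + f (suc n)

sumFin : (n : ℕ) → (Fin n → ℚ) → ℚ
sumFin zero    f = 0ℚ
sumFin (suc n) f = f Fin.zero + sumFin n (λ m → f (Fin.suc m))

-- Polynomials in two variables α, β with rational coefficients,
-- represented by their coefficient function: P i j = coefficient of α^i β^j.

Poly2 : Set
Poly2 = ℕ → ℕ → ℚ

coeff : ℕ → ℕ → Poly2 → ℚ
coeff i j P = P i j

constP : ℚ → Poly2
constP c zero zero = c
constP c _    _    = 0ℚ

αP : Poly2
αP (suc zero) zero = 1ℚ
αP _          _    = 0ℚ

βP : Poly2
βP zero (suc zero) = 1ℚ
βP _    _          = 0ℚ

_⊕_ : Poly2 → Poly2 → Poly2
(p ⊕ q) i j = p i j + q i j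

_⊖_ : Poly2 → Poly2 → Poly2
(p ⊖ q) i j = p i j - q i j

scale : ℚ → Poly2 → Poly2
scale c p i j = c * p i j

_⊗_ : Poly2 → Poly2 → Poly2
(p ⊗ q) i j = sumTo i (λ a → sumTo j (λ b → p a b * q (i ∸ a) (j ∸ b)))

_^ᴾ_ : Poly2 → ℕ → Poly2
p ^ᴾ zero  = constP 1ℚ
p ^ᴾ suc n = p ⊗ (p ^ᴾ n)

sumFinP : (n : ℕ) → (Fin n → Poly2) → Poly2
sumFinP n f i j = sumFin n (λ m → f m i j)

-- For a variable x (α or β) and m ∈ [k], the factor
--   ((k-m)/(1-x) - (m-1)/x) · x^(m-1) (1-x)^(k-m)
-- is the polynomial
--   (k-m) x^(m-1) (1-x)^(k-m-1) - (m-1) x^(m-2) (1-x)^(k-m)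
-- (exact cancellation; when k-m = 0 resp. m-1 = 0 the corresponding
-- term vanishes, so truncated subtraction in the exponent is harmless).
gradFactor : Poly2 → ℕ → ℕ → Poly2
gradFactor x k m =
  scale (ℕ→ℚ (k ∸ m)) ((x ^ᴾ (m ∸ 1)) ⊗ ((constP 1ℚ ⊖ x) ^ᴾ (k ∸ m ∸ 1)))
  ⊖ scale (ℕ→ℚ (m ∸ 1)) ((x ^ᴾ (m ∸ 2)) ⊗ ((constP 1ℚ ⊖ x) ^ᴾ (k ∸ m)))

-- elements of [k] are represented by Fin k, with m ∈ Fin k standing
-- for the number toℕ m + 1 ∈ {1,…,k}
pos : {k : ℕ} → Fin k → ℕ
pos m = suc (toℕ m)

gradPoly : (k : ℕ) → Permutation′ k → Poly2
gradPoly k π = sumFinP k λ m →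
  let a = pos m
      b = pos (π ⟨$⟩ʳ m)
  in scale (ℕ→ℚ (k !) * invFact (a ∸ 1) * invFact (k ∸ a)
                      * invFact (b ∸ 1) * invFact (k ∸ b))
           (gradFactor αP k a ⊗ gradFactor βP k b)

permMatrix : (k : ℕ) → Permutation′ k → Fin k → Fin k → ℚ
permMatrix k π i j with (π ⟨$⟩ʳ i) ≟ j
... | yes _ = 1ℚ
... | no  _ = 0ℚ

bvec : (k : ℕ) → ℕ → Fin k → ℚ
bvec k a i with toℕ i <? a
... | yes _ = neg1^ (toℕ i) * ℕ→ℚ ((a ∸ 1) C (toℕ i))
... | no  _ = 0ℚ

bilin : (k : ℕ) → (Fin k → ℚ) → (Fin k → Fin k → ℚ) → (Fin k → ℚ) → ℚ
bilin k u M v = sumFin k λ i → sumFin k λ j → u i * M i j * v j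

-- Every summand of P_π is a product f(α) g(β) of univariate polynomials,
-- and the factor belonging to position t + 1 is −(d/dx)(x^t (1 − x)^n) with
-- n = k − t − 1. So its coefficient of x^i, divided by t! n!, is
-- −(i + 1) (−1)^d C(n, d) / (t! n!) with d = i + 1 − t. This vanishes unless
-- t ≤ i + 1 and d ≤ n, i.e. unless i ≤ k − 2, and is then
-- (−1)^i (−1)^t C(i + 1, t) / (i! (k − i − 2)!): up to the scalar
-- (−1)^i / (i! (k − i − 2)!) it is the (t + 1)-st entry of b_{i+2}. Summing the
-- products of these coefficients over m gives b_{i+2}ᵀ A_π b_{j+2}.

module Submission where

open import Defs
open import Data.Nat as ℕ using (ℕ; zero; suc; _+_; _≤_; _<_; _∸_; _!; z≤n; s≤s; _<?_; _≤?_)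
import Data.Nat.Properties as ℕP
open import Data.Nat.Properties using (_!≢0)
open import Data.Nat.Combinatorics using (_C_; k>n⇒nCk≡0; nCk+nC[k+1]≡[n+1]C[k+1]; k![n∸k]!∣n!)
open import Data.Nat.Combinatorics.Specification using (nCk≡n!/k![n-k]!)
open import Data.Nat.DivMod using (m/n*n≡m)
import Data.Nat.Solver as ℕSolver
import Data.Integer as ℤ
import Data.Integer.Properties as ℤP
open import Data.Rational as ℚ using (ℚ; 0ℚ; 1ℚ; _*_; _-_; -_; mkℚ)
import Data.Rational.Properties as ℚP
open import Data.Rational.Solver using (module +-*-Solver)
open import Data.Nat.Coprimality as Coprime using (1-coprimeTo)
open import Data.Product using (_,_; _×_)
open import Data.Sum using (inj₁; inj₂)
open import Data.Fin as Fin using (Fin; toℕ)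
import Data.Fin.Properties as FinP
open import Function using (_∘_)
open import Data.Fin.Permutation using (Permutation′; _⟨$⟩ʳ_)
open import Relation.Nullary using (¬_; yes; no; contradiction)
open import Relation.Binary.PropositionalEquality
open import Relation.Binary.Definitions using (tri<; tri≈; tri>)
open +-*-Solver
open ℕSolver.+-*-Solver using () renaming (solve to solveℕ; _:*_ to _⊠_; _:=_ to _≐_)

-- Factorials and binomial coefficients

ℕ→ℚ-normal : ∀ n → ℕ→ℚ n ≡ mkℚ (ℤ.+ n) 0 (Coprime.sym (1-coprimeTo n))
ℕ→ℚ-normal n = ℚP.normalize-coprime (Coprime.sym (1-coprimeTo n))

ℕ→ℚ-+ : ∀ m n → ℕ→ℚ (m + n) ≡ ℕ→ℚ m ℚ.+ ℕ→ℚ n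
ℕ→ℚ-+ m n = sym (trans (cong₂ ℚ._+_ (ℕ→ℚ-normal m) (ℕ→ℚ-normal n))
  (ℚP./-cong {p₁ = ℤ.+ m ℤ.* ℤ.+ 1 ℤ.+ ℤ.+ n ℤ.* ℤ.+ 1} {q₁ = 1}
    (trans (cong₂ ℤ._+_ (ℤP.*-identityʳ (ℤ.+ m)) (ℤP.*-identityʳ (ℤ.+ n))) (sym (ℤP.pos-+ m n)))
    refl))

ℕ→ℚ-* : ∀ m n → ℕ→ℚ (m ℕ.* n) ≡ ℕ→ℚ m * ℕ→ℚ n
ℕ→ℚ-* m n = sym (trans (cong₂ _*_ (ℕ→ℚ-normal m) (ℕ→ℚ-normal n))
  (ℚP./-cong {p₁ = ℤ.+ m ℤ.* ℤ.+ n} {q₁ = 1} (sym (ℤP.pos-* m n)) refl))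

invFact-inverseˡ : ∀ n → invFact n * ℕ→ℚ (n !) ≡ 1ℚ
invFact-inverseˡ n with n ! | n !≢0
... | suc p | _ = trans
  (cong₂ _*_ (ℚP.normalize-coprime (1-coprimeTo (suc p))) (ℕ→ℚ-normal (suc p)))
  (ℚP.*-inverseˡ (mkℚ (ℤ.+ suc p) 0 (Coprime.sym (1-coprimeTo (suc p)))))

invFact-cross : ∀ a b u v x y → a ℕ.* (x ! ℕ.* y !) ≡ b ℕ.* (u ! ℕ.* v !) →
  ℕ→ℚ a * invFact u * invFact v ≡ ℕ→ℚ b * invFact x * invFact y
invFact-cross a b u v x y eq = begin
  ℕ→ℚ a * invFact u * invFact v
    ≡⟨ expand a u v x y ⟩
  ℕ→ℚ (a ℕ.* (x ! ℕ.* y !)) * (invFact x * invFact y * invFact u * invFact v)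
    ≡⟨ cong (λ n → ℕ→ℚ n * (invFact x * invFact y * invFact u * invFact v)) eq ⟩
  ℕ→ℚ (b ℕ.* (u ! ℕ.* v !)) * (invFact x * invFact y * invFact u * invFact v)
    ≡⟨ cong (ℕ→ℚ (b ℕ.* (u ! ℕ.* v !)) *_) (solve 4 (λ p q r s → p :* q :* r :* s := r :* s :* p :* q) refl
         (invFact x) (invFact y) (invFact u) (invFact v)) ⟩
  ℕ→ℚ (b ℕ.* (u ! ℕ.* v !)) * (invFact u * invFact v * invFact x * invFact y)
    ≡⟨ sym (expand b x y u v) ⟩
  ℕ→ℚ b * invFact x * invFact y ∎
  where
  open ≡-Reasoning
  expand : ∀ a u v x y → ℕ→ℚ a * invFact u * invFact v
                       ≡ ℕ→ℚ (a ℕ.* (x ! ℕ.* y !)) * (invFact x * invFact y * invFact u * invFact v)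
  expand a u v x y = begin
    ℕ→ℚ a * invFact u * invFact v
      ≡⟨ solve 3 (λ p q r → p :* q :* r := p :* q :* r :* con 1ℚ :* con 1ℚ) refl
           (ℕ→ℚ a) (invFact u) (invFact v) ⟩
    ℕ→ℚ a * invFact u * invFact v * 1ℚ * 1ℚ
      ≡⟨ cong₂ (λ p q → ℕ→ℚ a * invFact u * invFact v * p * q)
           (sym (invFact-inverseˡ x)) (sym (invFact-inverseˡ y)) ⟩
    ℕ→ℚ a * invFact u * invFact v * (invFact x * ℕ→ℚ (x !)) * (invFact y * ℕ→ℚ (y !))
      ≡⟨ solve 7 (λ A U V X X! Y Y! → A :* U :* V :* (X :* X!) :* (Y :* Y!)
                                      := A :* (X! :* Y!) :* (X :* Y :* U :* V)) refl
           (ℕ→ℚ a) (invFact u) (invFact v) (invFact x) (ℕ→ℚ (x !)) (invFact y) (ℕ→ℚ (y !)) ⟩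
    ℕ→ℚ a * (ℕ→ℚ (x !) * ℕ→ℚ (y !)) * (invFact x * invFact y * invFact u * invFact v)
      ≡⟨ cong (_* (invFact x * invFact y * invFact u * invFact v))
           (sym (trans (ℕ→ℚ-* a (x ! ℕ.* y !)) (cong (ℕ→ℚ a *_) (ℕ→ℚ-* (x !) (y !))))) ⟩
    ℕ→ℚ (a ℕ.* (x ! ℕ.* y !)) * (invFact x * invFact y * invFact u * invFact v) ∎

[m+n]Cm*[m!*n!]≡[m+n]! : ∀ m n → ((m + n) C m) ℕ.* (m ! ℕ.* n !) ≡ (m + n) !
[m+n]Cm*[m!*n!]≡[m+n]! m n
  with nCk≡n!/k![n-k]! (ℕP.m≤m+n m n) | k![n∸k]!∣n! (ℕP.m≤m+n m n)
... | C≡ | ∣! rewrite ℕP.m+n∸m≡n m n =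
  trans (cong (ℕ._* (m ! ℕ.* n !)) C≡) (m/n*n≡m {{ℕP.m*n≢0 (m !) (n !) {{m !≢0}} {{n !≢0}}}} ∣!)

*-cancelʳ-[m!*n!] : ∀ a b m n → a ℕ.* (m ! ℕ.* n !) ≡ b ℕ.* (m ! ℕ.* n !) → a ≡ b
*-cancelʳ-[m!*n!] a b m n = ℕP.*-cancelʳ-≡ a b (m ! ℕ.* n !) {{ℕP.m*n≢0 (m !) (n !) {{m !≢0}} {{n !≢0}}}}

n*[n∸1]Ck≡[1+k]*nC[1+k] : ∀ n k → n ℕ.* ((n ∸ 1) C k) ≡ suc k ℕ.* (n C suc k)
n*[n∸1]Ck≡[1+k]*nC[1+k] zero k = sym (ℕP.*-zeroʳ (suc k))
n*[n∸1]Ck≡[1+k]*nC[1+k] (suc n) k with ℕP.≤-<-connex k n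
... | inj₂ n<k = trans (cong (suc n ℕ.*_) (k>n⇒nCk≡0 n<k))
  (trans (ℕP.*-zeroʳ (suc n)) (sym (trans (cong (suc k ℕ.*_) (k>n⇒nCk≡0 (s≤s n<k))) (ℕP.*-zeroʳ (suc k)))))
... | inj₁ k≤n with ℕP.m≤n⇒∃[o]m+o≡n k≤n
...   | e , refl = *-cancelʳ-[m!*n!] _ _ k e (begin
  suc (k + e) ℕ.* ((k + e) C k) ℕ.* (k ! ℕ.* e !)
    ≡⟨ ℕP.*-assoc (suc (k + e)) ((k + e) C k) (k ! ℕ.* e !) ⟩
  suc (k + e) ℕ.* (((k + e) C k) ℕ.* (k ! ℕ.* e !))
    ≡⟨ cong (suc (k + e) ℕ.*_) ([m+n]Cm*[m!*n!]≡[m+n]! k e) ⟩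
  suc (k + e) !
    ≡⟨ sym ([m+n]Cm*[m!*n!]≡[m+n]! (suc k) e) ⟩
  ((suc k + e) C suc k) ℕ.* (suc k ! ℕ.* e !)
    ≡⟨ regroup ((suc k + e) C suc k) (suc k) (k !) (e !) ⟩
  suc k ℕ.* ((suc k + e) C suc k) ℕ.* (k ! ℕ.* e !) ∎)
  where
  open ≡-Reasoning
  regroup : ∀ c s f g → c ℕ.* (s ℕ.* f ℕ.* g) ≡ s ℕ.* c ℕ.* (f ℕ.* g)
  regroup = solveℕ 4 (λ c s f g → c ⊠ (s ⊠ f ⊠ g) ≐ s ⊠ c ⊠ (f ⊠ g)) refl

[1+i]*[d+e]Cd*[i!*e!]≡[1+i]Ct*[t!*[d+e]!] : ∀ t d e i → t + d ≡ suc i →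
  suc i ℕ.* ((d + e) C d) ℕ.* (i ! ℕ.* e !) ≡ (suc i C t) ℕ.* (t ! ℕ.* (d + e) !)
[1+i]*[d+e]Cd*[i!*e!]≡[1+i]Ct*[t!*[d+e]!] t d e i t+d≡1+i =
  ℕP.*-cancelʳ-≡ _ _ (d !) {{d !≢0}} (begin
    suc i ℕ.* ((d + e) C d) ℕ.* (i ! ℕ.* e !) ℕ.* d !
      ≡⟨ solveℕ 5 (λ s c f g h → s ⊠ c ⊠ (f ⊠ g) ⊠ h ≐ s ⊠ f ⊠ (c ⊠ (h ⊠ g))) refl
           (suc i) ((d + e) C d) (i !) (e !) (d !) ⟩
    suc i ! ℕ.* (((d + e) C d) ℕ.* (d ! ℕ.* e !))
      ≡⟨ cong (suc i ! ℕ.*_) ([m+n]Cm*[m!*n!]≡[m+n]! d e) ⟩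
    suc i ! ℕ.* (d + e) !
      ≡⟨ cong (ℕ._* (d + e) !)
           (sym (subst (λ n → (n C t) ℕ.* (t ! ℕ.* d !) ≡ n !) t+d≡1+i ([m+n]Cm*[m!*n!]≡[m+n]! t d))) ⟩
    (suc i C t) ℕ.* (t ! ℕ.* d !) ℕ.* (d + e) !
      ≡⟨ solveℕ 4 (λ c f g h → c ⊠ (f ⊠ g) ⊠ h ≐ c ⊠ (f ⊠ h) ⊠ g) refl (suc i C t) (t !) (d !) ((d + e) !) ⟩
    (suc i C t) ℕ.* (t ! ℕ.* (d + e) !) ℕ.* d ! ∎)
  where open ≡-Reasoning

neg1^-+ : ∀ m n → neg1^ (m + n) ≡ neg1^ m * neg1^ n
neg1^-+ zero    n = sym (ℚP.*-identityˡ (neg1^ n))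
neg1^-+ (suc m) n = trans (cong -_ (neg1^-+ m n)) (ℚP.neg-distribˡ-* (neg1^ m) (neg1^ n))

neg1^-square : ∀ n → neg1^ n * neg1^ n ≡ 1ℚ
neg1^-square zero    = refl
neg1^-square (suc n) = trans (solve 1 (λ x → :- x :* :- x := x :* x) refl (neg1^ n)) (neg1^-square n)

-neg1^≡neg1^*neg1^ : ∀ t d i → t + d ≡ suc i → - neg1^ d ≡ neg1^ i * neg1^ t
-neg1^≡neg1^*neg1^ t d i t+d≡1+i = begin
  - neg1^ d
    ≡⟨ solve 1 (λ x → :- x := :- x :* con 1ℚ) refl (neg1^ d) ⟩
  - neg1^ d * 1ℚ
    ≡⟨ cong (- neg1^ d *_) (sym (neg1^-square t)) ⟩
  - neg1^ d * (neg1^ t * neg1^ t)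
    ≡⟨ solve 2 (λ x y → :- x :* (y :* y) := :- (y :* x) :* y) refl (neg1^ d) (neg1^ t) ⟩
  - (neg1^ t * neg1^ d) * neg1^ t
    ≡⟨ cong (λ s → - s * neg1^ t) (trans (sym (neg1^-+ t d)) (cong neg1^ t+d≡1+i)) ⟩
  - (- neg1^ i) * neg1^ t
    ≡⟨ solve 2 (λ x y → :- (:- x) :* y := x :* y) refl (neg1^ i) (neg1^ t) ⟩
  neg1^ i * neg1^ t ∎
  where open ≡-Reasoning

sumTo-cong : ∀ n {f g : ℕ → ℚ} → (∀ a → f a ≡ g a) → sumTo n f ≡ sumTo n g
sumTo-cong zero    f≗g = f≗g 0
sumTo-cong (suc n) f≗g = cong₂ ℚ._+_ (sumTo-cong n f≗g) (f≗g (suc n))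

sumTo-zero : ∀ n {f : ℕ → ℚ} → (∀ a → a ≤ n → f a ≡ 0ℚ) → sumTo n f ≡ 0ℚ
sumTo-zero zero    f≡0 = f≡0 0 z≤n
sumTo-zero (suc n) f≡0 =
  cong₂ ℚ._+_ (sumTo-zero n (λ a a≤n → f≡0 a (ℕP.m≤n⇒m≤1+n a≤n))) (f≡0 (suc n) ℕP.≤-refl)

sumTo-head : ∀ n (f : ℕ → ℚ) → sumTo (suc n) f ≡ f 0 ℚ.+ sumTo n (λ a → f (suc a))
sumTo-head zero    f = refl
sumTo-head (suc n) f = trans (cong (ℚ._+ f (suc (suc n))) (sumTo-head n f)) (ℚP.+-assoc (f 0) _ _)

sumTo-first : ∀ n {f : ℕ → ℚ} → (∀ a → f (suc a) ≡ 0ℚ) → sumTo n f ≡ f 0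
sumTo-first zero    f≡0 = refl
sumTo-first (suc n) {f} f≡0 = begin
  sumTo (suc n) f                       ≡⟨ sumTo-head n f ⟩
  f 0 ℚ.+ sumTo n (λ a → f (suc a))     ≡⟨ cong (f 0 ℚ.+_) (sumTo-zero n (λ a _ → f≡0 a)) ⟩
  f 0 ℚ.+ 0ℚ                            ≡⟨ ℚP.+-identityʳ (f 0) ⟩
  f 0                                   ∎
  where open ≡-Reasoning

sumTo-last : ∀ n {f : ℕ → ℚ} → (∀ a → a ≤ n → f a ≡ 0ℚ) → sumTo (suc n) f ≡ f (suc n)
sumTo-last n {f} f≡0 = trans (cong (ℚ._+ f (suc n)) (sumTo-zero n f≡0)) (ℚP.+-identityˡ (f (suc n)))

sumTo-sub : ∀ n (f g : ℕ → ℚ) → sumTo n (λ a → f a - g a) ≡ sumTo n f - sumTo n g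
sumTo-sub zero    f g = refl
sumTo-sub (suc n) f g = trans (cong (ℚ._+ (f (suc n) - g (suc n))) (sumTo-sub n f g))
  (solve 4 (λ F G x y → (F :- G) :+ (x :- y) := (F :+ x) :- (G :+ y)) refl
    (sumTo n f) (sumTo n g) (f (suc n)) (g (suc n)))

sumFin-cong : ∀ n {f g : Fin n → ℚ} → (∀ m → f m ≡ g m) → sumFin n f ≡ sumFin n g
sumFin-cong zero    f≗g = refl
sumFin-cong (suc n) f≗g = cong₂ ℚ._+_ (f≗g Fin.zero) (sumFin-cong n (λ m → f≗g (Fin.suc m)))

sumFin-zero : ∀ n {f : Fin n → ℚ} → (∀ m → f m ≡ 0ℚ) → sumFin n f ≡ 0ℚ
sumFin-zero zero    f≡0 = refl
sumFin-zero (suc n) f≡0 = cong₂ ℚ._+_ (f≡0 Fin.zero) (sumFin-zero n (λ m → f≡0 (Fin.suc m)))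

sumFin-*ˡ : ∀ n c (f : Fin n → ℚ) → sumFin n (λ m → c * f m) ≡ c * sumFin n f
sumFin-*ˡ zero    c f = sym (ℚP.*-zeroʳ c)
sumFin-*ˡ (suc n) c f = trans (cong (c * f Fin.zero ℚ.+_) (sumFin-*ˡ n c (λ m → f (Fin.suc m))))
  (sym (ℚP.*-distribˡ-+ c (f Fin.zero) _))

sumFin-select : ∀ n (x : Fin n) {f : Fin n → ℚ} → (∀ m → x ≢ m → f m ≡ 0ℚ) → sumFin n f ≡ f x
sumFin-select (suc n) Fin.zero {f} f≡0 =
  trans (cong (f Fin.zero ℚ.+_) (sumFin-zero n (λ m → f≡0 (Fin.suc m) (λ ())))) (ℚP.+-identityʳ (f Fin.zero))
sumFin-select (suc n) (Fin.suc x) {f} f≡0 =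
  trans (cong₂ ℚ._+_ (f≡0 Fin.zero (λ ()))
                     (sumFin-select n x (λ m x≢m → f≡0 (Fin.suc m) (x≢m ∘ FinP.suc-injective))))
        (ℚP.+-identityˡ (f (Fin.suc x)))

-- Formal power series in one variable

Series : Set
Series = ℕ → ℚ

infixl 7 _⋆_
_⋆_ : Series → Series → Series
(u ⋆ v) i = sumTo i (λ a → u a * v (i ∸ a))

infixr 8 _^⋆_
_^⋆_ : Series → ℕ → Series

monomial : ℕ → Series
monomial zero    zero    = 1ℚ
monomial zero    (suc _) = 0ℚ
monomial (suc a) zero    = 0ℚ
monomial (suc a) (suc i) = monomial a i

u ^⋆ zero  = monomial 0
u ^⋆ suc n = u ⋆ u ^⋆ n

X : Series
X = monomial 1

oneMinusX : Series
oneMinusX i = monomial 0 i - X i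

⋆-congˡ : ∀ {u u′} v → u ≗ u′ → u ⋆ v ≗ u′ ⋆ v
⋆-congˡ v u≗u′ i = sumTo-cong i (λ a → cong (_* v (i ∸ a)) (u≗u′ a))

⋆-congʳ : ∀ u {v v′} → v ≗ v′ → u ⋆ v ≗ u ⋆ v′
⋆-congʳ u v≗v′ i = sumTo-cong i (λ a → cong (u a *_) (v≗v′ (i ∸ a)))

⋆-identityˡ : ∀ w → monomial 0 ⋆ w ≗ w
⋆-identityˡ w i = trans (sumTo-first i (λ a → ℚP.*-zeroˡ (w (i ∸ suc a)))) (ℚP.*-identityˡ (w i))

monomial-suc-⋆ : ∀ a w i → (monomial (suc a) ⋆ w) (suc i) ≡ (monomial a ⋆ w) i
monomial-suc-⋆ a w i = begin
  (monomial (suc a) ⋆ w) (suc i)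
    ≡⟨ sumTo-head i _ ⟩
  0ℚ * w (suc i) ℚ.+ (monomial a ⋆ w) i
    ≡⟨ cong (ℚ._+ (monomial a ⋆ w) i) (ℚP.*-zeroˡ (w (suc i))) ⟩
  0ℚ ℚ.+ (monomial a ⋆ w) i
    ≡⟨ ℚP.+-identityˡ _ ⟩
  (monomial a ⋆ w) i ∎
  where open ≡-Reasoning

monomial-⋆-+ : ∀ a w d → (monomial a ⋆ w) (a + d) ≡ w d
monomial-⋆-+ zero    w d = ⋆-identityˡ w d
monomial-⋆-+ (suc a) w d = trans (monomial-suc-⋆ a w (a + d)) (monomial-⋆-+ a w d)

monomial-⋆-< : ∀ {a i} w → i < a → (monomial a ⋆ w) i ≡ 0ℚ
monomial-⋆-< {suc a} {zero}  w _         = ℚP.*-zeroˡ (w 0)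
monomial-⋆-< {suc a} {suc i} w (s≤s i<a) = trans (monomial-suc-⋆ a w i) (monomial-⋆-< w i<a)

X^⋆≗monomial : ∀ a → X ^⋆ a ≗ monomial a
X^⋆≗monomial zero    i = refl
X^⋆≗monomial (suc a) i = trans (⋆-congʳ X (X^⋆≗monomial a) i) (X⋆monomial i)
  where
  X⋆monomial : X ⋆ monomial a ≗ monomial (suc a)
  X⋆monomial zero    = monomial-⋆-< {1} (monomial a) (s≤s z≤n)
  X⋆monomial (suc i) = monomial-⋆-+ 1 (monomial a) i

⋆-distribʳ-sub : ∀ u v w i → ((λ a → u a - v a) ⋆ w) i ≡ (u ⋆ w) i - (v ⋆ w) i
⋆-distribʳ-sub u v w i = trans
  (sumTo-cong i (λ a → solve 3 (λ x y z → (x :- y) :* z := x :* z :- y :* z) refl (u a) (v a) (w (i ∸ a))))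
  (sumTo-sub i (λ a → u a * w (i ∸ a)) (λ a → v a * w (i ∸ a)))

oneMinusX-⋆-zero : ∀ w → (oneMinusX ⋆ w) 0 ≡ w 0
oneMinusX-⋆-zero w = ℚP.*-identityˡ (w 0)

oneMinusX-⋆-suc : ∀ w i → (oneMinusX ⋆ w) (suc i) ≡ w (suc i) - w i
oneMinusX-⋆-suc w i = trans (⋆-distribʳ-sub (monomial 0) X w (suc i))
  (cong₂ _-_ (⋆-identityˡ w (suc i)) (monomial-⋆-+ 1 w i))

oneMinusX^⋆ : ∀ b i → (oneMinusX ^⋆ b) i ≡ neg1^ i * ℕ→ℚ (b C i)
oneMinusX^⋆ zero    zero    = refl
oneMinusX^⋆ zero    (suc i) = sym (ℚP.*-zeroʳ (neg1^ (suc i)))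
oneMinusX^⋆ (suc b) zero    = trans (oneMinusX-⋆-zero (oneMinusX ^⋆ b)) (oneMinusX^⋆ b zero)
oneMinusX^⋆ (suc b) (suc i) = begin
  (oneMinusX ^⋆ suc b) (suc i)
    ≡⟨ oneMinusX-⋆-suc (oneMinusX ^⋆ b) i ⟩
  (oneMinusX ^⋆ b) (suc i) - (oneMinusX ^⋆ b) i
    ≡⟨ cong₂ _-_ (oneMinusX^⋆ b (suc i)) (oneMinusX^⋆ b i) ⟩
  - neg1^ i * ℕ→ℚ (b C suc i) - neg1^ i * ℕ→ℚ (b C i)
    ≡⟨ solve 3 (λ s x y → :- s :* y :- s :* x := :- s :* (x :+ y)) refl
         (neg1^ i) (ℕ→ℚ (b C i)) (ℕ→ℚ (b C suc i)) ⟩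
  - neg1^ i * (ℕ→ℚ (b C i) ℚ.+ ℕ→ℚ (b C suc i))
    ≡⟨ cong (- neg1^ i *_) (sym (ℕ→ℚ-+ (b C i) (b C suc i))) ⟩
  - neg1^ i * ℕ→ℚ (b C i + b C suc i)
    ≡⟨ cong (λ c → - neg1^ i * ℕ→ℚ c) (nCk+nC[k+1]≡[n+1]C[k+1] b i) ⟩
  neg1^ (suc i) * ℕ→ℚ (suc b C suc i) ∎
  where open ≡-Reasoning

basis : ℕ → ℕ → Series
basis a b = X ^⋆ a ⋆ oneMinusX ^⋆ b

basis≗monomial-⋆ : ∀ a b → basis a b ≗ monomial a ⋆ oneMinusX ^⋆ b
basis≗monomial-⋆ a b = ⋆-congˡ (oneMinusX ^⋆ b) (X^⋆≗monomial a)

basis-+ : ∀ a b d → basis a b (a + d) ≡ neg1^ d * ℕ→ℚ (b C d)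
basis-+ a b d = trans (basis≗monomial-⋆ a b (a + d))
  (trans (monomial-⋆-+ a (oneMinusX ^⋆ b) d) (oneMinusX^⋆ b d))

basis-< : ∀ {a i} b → i < a → basis a b i ≡ 0ℚ
basis-< {a} {i} b i<a = trans (basis≗monomial-⋆ a b i) (monomial-⋆-< (oneMinusX ^⋆ b) i<a)

basis-suc : ∀ a b i → basis (suc a) b (suc i) ≡ basis a b i
basis-suc a b i = trans (basis≗monomial-⋆ (suc a) b (suc i))
  (trans (monomial-suc-⋆ a (oneMinusX ^⋆ b) i) (sym (basis≗monomial-⋆ a b i)))

*-basis-pred : ∀ t b i → ℕ→ℚ t * basis (t ∸ 1) b i ≡ ℕ→ℚ t * basis t b (suc i)
*-basis-pred zero    b i = trans (ℚP.*-zeroˡ (basis 0 b i)) (sym (ℚP.*-zeroˡ (basis 0 b (suc i))))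
*-basis-pred (suc t) b i = cong (ℕ→ℚ (suc t) *_) (sym (basis-suc t b i))

gradSeries : ℕ → ℕ → Series
gradSeries t n i = ℕ→ℚ n * basis t (n ∸ 1) i - ℕ→ℚ t * basis (t ∸ 1) n i

gradSeries-+ : ∀ t n d → gradSeries t n (t + d) ≡ - (ℕ→ℚ (suc (t + d)) * basis t n (suc (t + d)))
gradSeries-+ t n d = begin
  N * basis t (n ∸ 1) (t + d) - T * basis (t ∸ 1) n (t + d)
    ≡⟨ cong (λ q → N * basis t (n ∸ 1) (t + d) - q) (*-basis-pred t n (t + d)) ⟩
  N * basis t (n ∸ 1) (t + d) - T * basis t n (suc (t + d))
    ≡⟨ cong₂ (λ p q → N * p - T * q) (basis-+ t (n ∸ 1) d) basis-next ⟩
  N * (s * A) - T * (- s * c)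
    ≡⟨ solve 5 (λ N s A T c → N :* (s :* A) :- T :* (:- s :* c) := s :* (N :* A) :+ s :* (T :* c))
         refl N s A T c ⟩
  s * (N * A) ℚ.+ s * (T * c)
    ≡⟨ cong (λ z → s * z ℚ.+ s * (T * c)) absorb ⟩
  s * (D * c) ℚ.+ s * (T * c)
    ≡⟨ solve 4 (λ s D T c → s :* (D :* c) :+ s :* (T :* c) := :- ((T :+ D) :* (:- s :* c))) refl s D T c ⟩
  - ((T ℚ.+ D) * (- s * c))
    ≡⟨ cong₂ (λ p q → - (p * q))
         (sym (trans (cong ℕ→ℚ (sym (ℕP.+-suc t d))) (ℕ→ℚ-+ t (suc d)))) (sym basis-next) ⟩
  - (ℕ→ℚ (suc (t + d)) * basis t n (suc (t + d))) ∎
  where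
  open ≡-Reasoning
  N = ℕ→ℚ n
  T = ℕ→ℚ t
  D = ℕ→ℚ (suc d)
  s = neg1^ d
  A = ℕ→ℚ ((n ∸ 1) C d)
  c = ℕ→ℚ (n C suc d)
  basis-next : basis t n (suc (t + d)) ≡ - s * c
  basis-next = trans (cong (basis t n) (sym (ℕP.+-suc t d))) (basis-+ t n (suc d))
  absorb : N * A ≡ D * c
  absorb = trans (sym (ℕ→ℚ-* n ((n ∸ 1) C d)))
    (trans (cong ℕ→ℚ (n*[n∸1]Ck≡[1+k]*nC[1+k] n d)) (ℕ→ℚ-* (suc d) (n C suc d)))

gradSeries≡-derivative : ∀ t n i → gradSeries t n i ≡ - (ℕ→ℚ (suc i) * basis t n (suc i))
gradSeries≡-derivative t n i with ℕP.<-cmp t (suc i)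
... | tri< t<1+i _ _ = subst (λ j → gradSeries t n j ≡ - (ℕ→ℚ (suc j) * basis t n (suc j)))
  (ℕP.m+[n∸m]≡n (ℕP.≤-pred t<1+i)) (gradSeries-+ t n (i ∸ t))
... | tri≈ _ refl _ = trans
  (cong (λ z → ℕ→ℚ n * z - ℕ→ℚ (suc i) * basis i n i) (basis-< (n ∸ 1) (ℕP.n<1+n i)))
  (trans (cong (λ q → ℕ→ℚ n * 0ℚ - q) (*-basis-pred (suc i) n i))
    (solve 3 (λ N S b → N :* con 0ℚ :- S :* b := :- (S :* b)) refl
      (ℕ→ℚ n) (ℕ→ℚ (suc i)) (basis (suc i) n (suc i))))
... | tri> _ _ 1+i<t = trans
  (cong₂ (λ p q → ℕ→ℚ n * p - q) (basis-< (n ∸ 1) (ℕP.<-trans (ℕP.n<1+n i) 1+i<t))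
    (trans (*-basis-pred t n i) (cong (ℕ→ℚ t *_) (basis-< n 1+i<t))))
  (trans (solve 2 (λ N T → N :* con 0ℚ :- T :* con 0ℚ := :- (con 0ℚ)) refl (ℕ→ℚ n) (ℕ→ℚ t))
    (cong (λ z → - z) (sym (trans (cong (ℕ→ℚ (suc i) *_) (basis-< n 1+i<t)) (ℚP.*-zeroʳ (ℕ→ℚ (suc i)))))))

gradCoeff : ℕ → ℕ → Series
gradCoeff t n i = invFact t * invFact n * gradSeries t n i

gradCoeff-< : ∀ t n i → suc i < t → gradCoeff t n i ≡ 0ℚ
gradCoeff-< t n i 1+i<t = trans (cong (invFact t * invFact n *_) (gradSeries≡-derivative t n i))
  (trans (cong (λ b → invFact t * invFact n * - (ℕ→ℚ (suc i) * b)) (basis-< n 1+i<t))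
    (solve 3 (λ p q S → p :* q :* :- (S :* con 0ℚ) := con 0ℚ) refl (invFact t) (invFact n) (ℕ→ℚ (suc i))))

gradCoeff-+ : ∀ t n d i → t + d ≡ suc i →
  gradCoeff t n i ≡ - neg1^ d * (ℕ→ℚ (suc i ℕ.* (n C d)) * invFact t * invFact n)
gradCoeff-+ t n d i t+d≡1+i = begin
  invFact t * invFact n * gradSeries t n i
    ≡⟨ cong (invFact t * invFact n *_) (gradSeries≡-derivative t n i) ⟩
  invFact t * invFact n * - (ℕ→ℚ (suc i) * basis t n (suc i))
    ≡⟨ cong (λ b → invFact t * invFact n * - (ℕ→ℚ (suc i) * b))
         (trans (cong (basis t n) (sym t+d≡1+i)) (basis-+ t n d)) ⟩
  invFact t * invFact n * - (ℕ→ℚ (suc i) * (neg1^ d * ℕ→ℚ (n C d)))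
    ≡⟨ solve 5 (λ p q S s c → p :* q :* :- (S :* (s :* c)) := :- s :* (S :* c :* p :* q)) refl
         (invFact t) (invFact n) (ℕ→ℚ (suc i)) (neg1^ d) (ℕ→ℚ (n C d)) ⟩
  - neg1^ d * (ℕ→ℚ (suc i) * ℕ→ℚ (n C d) * invFact t * invFact n)
    ≡⟨ cong (λ z → - neg1^ d * (z * invFact t * invFact n)) (sym (ℕ→ℚ-* (suc i) (n C d))) ⟩
  - neg1^ d * (ℕ→ℚ (suc i ℕ.* (n C d)) * invFact t * invFact n) ∎
  where open ≡-Reasoning

gradCoeff-vanish : ∀ t n d i → t + d ≡ suc i → n < d → gradCoeff t n i ≡ 0ℚ
gradCoeff-vanish t n d i t+d≡1+i n<d = trans (gradCoeff-+ t n d i t+d≡1+i)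
  (trans (cong (λ c → - neg1^ d * (ℕ→ℚ (suc i ℕ.* c) * invFact t * invFact n)) (k>n⇒nCk≡0 n<d))
    (trans (cong (λ c → - neg1^ d * (ℕ→ℚ c * invFact t * invFact n)) (ℕP.*-zeroʳ (suc i)))
      (solve 3 (λ s p q → :- s :* (con 0ℚ :* p :* q) := con 0ℚ) refl (neg1^ d) (invFact t) (invFact n))))

gradCoeff-binomial : ∀ t d e i → t + d ≡ suc i →
  gradCoeff t (d + e) i ≡ neg1^ i * invFact i * invFact e * (neg1^ t * ℕ→ℚ (suc i C t))
gradCoeff-binomial t d e i t+d≡1+i = begin
  gradCoeff t (d + e) i
    ≡⟨ gradCoeff-+ t (d + e) d i t+d≡1+i ⟩
  - neg1^ d * (ℕ→ℚ (suc i ℕ.* ((d + e) C d)) * invFact t * invFact (d + e))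
    ≡⟨ cong₂ _*_ (-neg1^≡neg1^*neg1^ t d i t+d≡1+i)
         (invFact-cross (suc i ℕ.* ((d + e) C d)) (suc i C t) t (d + e) i e
           ([1+i]*[d+e]Cd*[i!*e!]≡[1+i]Ct*[t!*[d+e]!] t d e i t+d≡1+i)) ⟩
  neg1^ i * neg1^ t * (ℕ→ℚ (suc i C t) * invFact i * invFact e)
    ≡⟨ solve 5 (λ si st c p q → si :* st :* (c :* p :* q) := si :* p :* q :* (st :* c)) refl
         (neg1^ i) (neg1^ t) (ℕ→ℚ (suc i C t)) (invFact i) (invFact e) ⟩
  neg1^ i * invFact i * invFact e * (neg1^ t * ℕ→ℚ (suc i C t)) ∎
  where open ≡-Reasoning

bvec-< : ∀ k a (m : Fin k) → toℕ m < a → bvec k a m ≡ neg1^ (toℕ m) * ℕ→ℚ ((a ∸ 1) C toℕ m)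
bvec-< k a m m<a with toℕ m <? a
... | yes _   = refl
... | no m≮a = contradiction m<a m≮a

bvec-≮ : ∀ k a (m : Fin k) → ¬ toℕ m < a → bvec k a m ≡ 0ℚ
bvec-≮ k a m m≮a with toℕ m <? a
... | yes m<a = contradiction m<a m≮a
... | no _    = refl

t+d≡1+i⇒i+2≡1+t+d : ∀ t d i → t + d ≡ suc i → i + 2 ≡ suc t + d
t+d≡1+i⇒i+2≡1+t+d t d i t+d≡1+i = trans (ℕP.+-comm i 2) (cong suc (sym t+d≡1+i))

gradCoeff-in-range : ∀ k (m : Fin k) i → i + 2 ≤ k →
  gradCoeff (toℕ m) (k ∸ pos m) i ≡ neg1^ i * invFact i * invFact (k ∸ (i + 2)) * bvec k (i + 2) m
gradCoeff-in-range k m i i+2≤k with ℕP.<-≤-connex (suc i) (toℕ m)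
... | inj₁ 1+i<t = trans (gradCoeff-< (toℕ m) (k ∸ pos m) i 1+i<t)
  (sym (trans (cong (neg1^ i * invFact i * invFact (k ∸ (i + 2)) *_) (bvec-≮ k (i + 2) m m≮i+2))
              (ℚP.*-zeroʳ (neg1^ i * invFact i * invFact (k ∸ (i + 2))))))
  where
  m≮i+2 : ¬ toℕ m < i + 2
  m≮i+2 m<i+2 = ℕP.<-irrefl refl (ℕP.<-≤-trans 1+i<t (ℕP.≤-pred (subst (toℕ m <_) (ℕP.+-comm i 2) m<i+2)))
... | inj₂ t≤1+i with ℕP.m≤n⇒∃[o]m+o≡n t≤1+i
...   | d , t+d≡1+i = begin
  gradCoeff t (k ∸ suc t) i
    ≡⟨ cong (λ n → gradCoeff t n i) k∸1+t≡d+e ⟩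
  gradCoeff t (d + e) i
    ≡⟨ gradCoeff-binomial t d e i t+d≡1+i ⟩
  neg1^ i * invFact i * invFact e * (neg1^ t * ℕ→ℚ (suc i C t))
    ≡⟨ cong (λ c → neg1^ i * invFact i * invFact e * (neg1^ t * ℕ→ℚ (c C t))) (sym i+2∸1≡1+i) ⟩
  neg1^ i * invFact i * invFact e * (neg1^ t * ℕ→ℚ ((i + 2 ∸ 1) C t))
    ≡⟨ cong (neg1^ i * invFact i * invFact e *_) (sym (bvec-< k (i + 2) m t<i+2)) ⟩
  neg1^ i * invFact i * invFact e * bvec k (i + 2) m ∎
  where
  open ≡-Reasoning
  t = toℕ m
  e = k ∸ (i + 2)
  i+2∸1≡1+i : i + 2 ∸ 1 ≡ suc i
  i+2∸1≡1+i = cong (_∸ 1) (ℕP.+-comm i 2)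
  t<i+2 : t < i + 2
  t<i+2 = subst (t <_) (sym (ℕP.+-comm i 2)) (s≤s t≤1+i)
  k∸1+t≡d+e : k ∸ suc t ≡ d + e
  k∸1+t≡d+e = begin
    k ∸ suc t               ≡⟨ cong (_∸ suc t) (sym (ℕP.m+[n∸m]≡n i+2≤k)) ⟩
    i + 2 + e ∸ suc t       ≡⟨ cong (λ j → j + e ∸ suc t) (t+d≡1+i⇒i+2≡1+t+d t d i t+d≡1+i) ⟩
    suc t + d + e ∸ suc t   ≡⟨ cong (_∸ suc t) (ℕP.+-assoc (suc t) d e) ⟩
    suc t + (d + e) ∸ suc t ≡⟨ ℕP.m+n∸m≡n (suc t) (d + e) ⟩
    d + e                   ∎

gradCoeff-out-of-range : ∀ k (m : Fin k) i → ¬ i + 2 ≤ k → gradCoeff (toℕ m) (k ∸ pos m) i ≡ 0ℚ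
gradCoeff-out-of-range k m i i+2≰k with ℕP.<-≤-connex (suc i) (toℕ m)
... | inj₁ 1+i<t = gradCoeff-< (toℕ m) (k ∸ pos m) i 1+i<t
... | inj₂ t≤1+i with ℕP.m≤n⇒∃[o]m+o≡n t≤1+i
...   | d , t+d≡1+i = gradCoeff-vanish (toℕ m) (k ∸ pos m) d i t+d≡1+i
  (ℕP.+-cancelˡ-< (pos m) (k ∸ pos m) d
    (subst₂ _<_ (sym (ℕP.m+[n∸m]≡n (FinP.toℕ<n m))) (t+d≡1+i⇒i+2≡1+t+d (toℕ m) d i t+d≡1+i)
      (ℕP.≰⇒> i+2≰k)))

-- Series in α alone and in β alone

infix 4 _≈_
_≈_ : Poly2 → Poly2 → Set
p ≈ q = ∀ i j → p i j ≡ q i j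

⊗-cong : ∀ {p p′ q q′} → p ≈ p′ → q ≈ q′ → p ⊗ q ≈ p′ ⊗ q′
⊗-cong p≈p′ q≈q′ i j =
  sumTo-cong i (λ a → sumTo-cong j (λ b → cong₂ _*_ (p≈p′ a b) (q≈q′ (i ∸ a) (j ∸ b))))

record IsSeriesEmbedding (ι : Series → Poly2) (x : Poly2) : Set where
  field
    one-homo   : constP 1ℚ ≈ ι (monomial 0)
    var-homo   : x ≈ ι X
    ⊗-homo     : ∀ {p q u v} → p ≈ ι u → q ≈ ι v → p ⊗ q ≈ ι (u ⋆ v)
    ⊖-homo     : ∀ {p q u v} → p ≈ ι u → q ≈ ι v → p ⊖ q ≈ ι (λ i → u i - v i)
    scale-homo : ∀ c {p u} → p ≈ ι u → scale c p ≈ ι (λ i → c * u i)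

  ^ᴾ-homo : ∀ {p u} → p ≈ ι u → ∀ n → p ^ᴾ n ≈ ι (u ^⋆ n)
  ^ᴾ-homo p≈u zero    = one-homo
  ^ᴾ-homo p≈u (suc n) = ⊗-homo p≈u (^ᴾ-homo p≈u n)

  gradFactor-homo : ∀ k t → gradFactor x k (suc t) ≈ ι (gradSeries t (k ∸ suc t))
  gradFactor-homo k t = ⊖-homo
    (scale-homo (ℕ→ℚ (k ∸ suc t)) (⊗-homo (^ᴾ-homo var-homo t) (^ᴾ-homo oneMinus-homo (k ∸ suc t ∸ 1))))
    (scale-homo (ℕ→ℚ t) (⊗-homo (^ᴾ-homo var-homo (t ∸ 1)) (^ᴾ-homo oneMinus-homo (k ∸ suc t))))
    where
    oneMinus-homo : constP 1ℚ ⊖ x ≈ ι oneMinusX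
    oneMinus-homo = ⊖-homo one-homo var-homo

inα : Series → Poly2
inα u i zero    = u i
inα u i (suc _) = 0ℚ

inβ : Series → Poly2
inβ v zero    j = v j
inβ v (suc _) j = 0ℚ

inα-isSeriesEmbedding : IsSeriesEmbedding inα αP
inα-isSeriesEmbedding = record
  { one-homo   = one-homo
  ; var-homo   = var-homo
  ; ⊗-homo     = λ p≈u q≈v i j → trans (⊗-cong p≈u q≈v i j) (inα-⋆ i j)
  ; ⊖-homo     = ⊖-homo
  ; scale-homo = scale-homo
  }
  where
  one-homo : constP 1ℚ ≈ inα (monomial 0)
  one-homo zero    zero    = refl
  one-homo zero    (suc j) = refl
  one-homo (suc i) zero    = refl
  one-homo (suc i) (suc j) = refl
  var-homo : αP ≈ inα X
  var-homo zero          zero    = refl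
  var-homo zero          (suc j) = refl
  var-homo (suc zero)    zero    = refl
  var-homo (suc zero)    (suc j) = refl
  var-homo (suc (suc i)) zero    = refl
  var-homo (suc (suc i)) (suc j) = refl
  inα-⋆ : ∀ {u v} → inα u ⊗ inα v ≈ inα (u ⋆ v)
  inα-⋆ {u} {v} i zero    = refl
  inα-⋆ {u} {v} i (suc j) = sumTo-zero i (λ a _ → sumTo-zero (suc j) λ
    { zero    _ → ℚP.*-zeroʳ (u a)
    ; (suc b) _ → ℚP.*-zeroˡ (inα v (i ∸ a) (j ∸ b)) })
  ⊖-homo : ∀ {p q u v} → p ≈ inα u → q ≈ inα v → p ⊖ q ≈ inα (λ i → u i - v i)
  ⊖-homo p≈u q≈v i zero    = cong₂ _-_ (p≈u i zero) (q≈v i zero)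
  ⊖-homo p≈u q≈v i (suc j) = trans (cong₂ _-_ (p≈u i (suc j)) (q≈v i (suc j))) (ℚP.+-inverseʳ 0ℚ)
  scale-homo : ∀ c {p u} → p ≈ inα u → scale c p ≈ inα (λ i → c * u i)
  scale-homo c p≈u i zero    = cong (c *_) (p≈u i zero)
  scale-homo c p≈u i (suc j) = trans (cong (c *_) (p≈u i (suc j))) (ℚP.*-zeroʳ c)

inβ-isSeriesEmbedding : IsSeriesEmbedding inβ βP
inβ-isSeriesEmbedding = record
  { one-homo   = one-homo
  ; var-homo   = var-homo
  ; ⊗-homo     = λ p≈u q≈v i j → trans (⊗-cong p≈u q≈v i j) (inβ-⋆ i j)
  ; ⊖-homo     = ⊖-homo
  ; scale-homo = scale-homo
  }
  where
  one-homo : constP 1ℚ ≈ inβ (monomial 0)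
  one-homo zero    zero    = refl
  one-homo zero    (suc j) = refl
  one-homo (suc i) zero    = refl
  one-homo (suc i) (suc j) = refl
  var-homo : βP ≈ inβ X
  var-homo zero    zero          = refl
  var-homo zero    (suc zero)    = refl
  var-homo zero    (suc (suc j)) = refl
  var-homo (suc i) zero          = refl
  var-homo (suc i) (suc zero)    = refl
  var-homo (suc i) (suc (suc j)) = refl
  inβ-⋆ : ∀ {u v} → inβ u ⊗ inβ v ≈ inβ (u ⋆ v)
  inβ-⋆ {u} {v} zero    j = refl
  inβ-⋆ {u} {v} (suc i) j = sumTo-zero (suc i) λ
    { zero    _ → sumTo-zero j (λ b _ → ℚP.*-zeroʳ (u b))
    ; (suc a) _ → sumTo-zero j (λ b _ → ℚP.*-zeroˡ (inβ v (i ∸ a) (j ∸ b))) }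
  ⊖-homo : ∀ {p q u v} → p ≈ inβ u → q ≈ inβ v → p ⊖ q ≈ inβ (λ i → u i - v i)
  ⊖-homo p≈u q≈v zero    j = cong₂ _-_ (p≈u zero j) (q≈v zero j)
  ⊖-homo p≈u q≈v (suc i) j = trans (cong₂ _-_ (p≈u (suc i) j) (q≈v (suc i) j)) (ℚP.+-inverseʳ 0ℚ)
  scale-homo : ∀ c {p u} → p ≈ inβ u → scale c p ≈ inβ (λ i → c * u i)
  scale-homo c p≈u zero    j = cong (c *_) (p≈u zero j)
  scale-homo c p≈u (suc i) j = trans (cong (c *_) (p≈u (suc i) j)) (ℚP.*-zeroʳ c)

inα-⊗-inβ : ∀ u v i j → (inα u ⊗ inβ v) i j ≡ u i * v j
inα-⊗-inβ u v i j = trans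
  (sumTo-cong i (λ a → sumTo-first j (λ b → ℚP.*-zeroˡ (inβ v (i ∸ a) (j ∸ suc b)))))
  (outer i)
  where
  outer : ∀ i → sumTo i (λ a → u a * inβ v (i ∸ a) j) ≡ u i * v j
  outer zero    = refl
  outer (suc i) = trans
    (sumTo-last i (λ a a≤i → trans (cong (λ r → u a * inβ v r j) (ℕP.+-∸-assoc 1 a≤i)) (ℚP.*-zeroʳ (u a))))
    (cong (λ r → u (suc i) * inβ v r j) (ℕP.n∸n≡0 i))

gradPoly-coeff : ∀ k π i j → coeff i j (gradPoly k π) ≡
  sumFin k (λ m → ℕ→ℚ (k !) * gradCoeff (toℕ m) (k ∸ pos m) i
                            * gradCoeff (toℕ (π ⟨$⟩ʳ m)) (k ∸ pos (π ⟨$⟩ʳ m)) j)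
gradPoly-coeff k π i j = sumFin-cong k λ m →
  let t = toℕ m
      t′ = toℕ (π ⟨$⟩ʳ m)
  in trans
    (cong (ℕ→ℚ (k !) * invFact t * invFact (k ∸ suc t) * invFact t′ * invFact (k ∸ suc t′) *_)
      (trans (⊗-cong (IsSeriesEmbedding.gradFactor-homo inα-isSeriesEmbedding k t)
                     (IsSeriesEmbedding.gradFactor-homo inβ-isSeriesEmbedding k t′) i j)
             (inα-⊗-inβ _ _ i j)))
    (solve 7 (λ K a b c d g h → K :* a :* b :* c :* d :* (g :* h) := K :* (a :* b :* g) :* (c :* d :* h)) refl
      (ℕ→ℚ (k !)) (invFact t) (invFact (k ∸ suc t)) (invFact t′) (invFact (k ∸ suc t′))
      (gradSeries t (k ∸ suc t) i) (gradSeries t′ (k ∸ suc t′) j))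

-- Permutation matrices

permMatrix-hit : ∀ k π r → permMatrix k π r (π ⟨$⟩ʳ r) ≡ 1ℚ
permMatrix-hit k π r with (π ⟨$⟩ʳ r) Fin.≟ (π ⟨$⟩ʳ r)
... | yes _   = refl
... | no πr≢πr = contradiction refl πr≢πr

permMatrix-miss : ∀ k π r s → π ⟨$⟩ʳ r ≢ s → permMatrix k π r s ≡ 0ℚ
permMatrix-miss k π r s πr≢s with (π ⟨$⟩ʳ r) Fin.≟ s
... | yes πr≡s = contradiction πr≡s πr≢s
... | no _     = refl

bilin-permMatrix : ∀ k π u v → bilin k u (permMatrix k π) v ≡ sumFin k (λ r → u r * v (π ⟨$⟩ʳ r))
bilin-permMatrix k π u v = sumFin-cong k λ r → trans
  (sumFin-select k (π ⟨$⟩ʳ r) (λ s πr≢s →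
    trans (cong (λ a → u r * a * v s) (permMatrix-miss k π r s πr≢s))
          (solve 2 (λ x y → x :* con 0ℚ :* y := con 0ℚ) refl (u r) (v s))))
  (trans (cong (λ a → u r * a * v (π ⟨$⟩ʳ r)) (permMatrix-hit k π r))
         (solve 2 (λ x y → x :* con 1ℚ :* y := x :* y) refl (u r) (v (π ⟨$⟩ʳ r))))

gradPoly-coeff-out-of-range : ∀ k π i j → ¬ (i + 2 ≤ k × j + 2 ≤ k) → coeff i j (gradPoly k π) ≡ 0ℚ
gradPoly-coeff-out-of-range k π i j out-of-range = trans (gradPoly-coeff k π i j) (sumFin-zero k summand≡0)
  where
  K = ℕ→ℚ (k !)
  summand≡0 : ∀ m → K * gradCoeff (toℕ m) (k ∸ pos m) i
                      * gradCoeff (toℕ (π ⟨$⟩ʳ m)) (k ∸ pos (π ⟨$⟩ʳ m)) j ≡ 0ℚ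
  summand≡0 m with i + 2 ≤? k
  ... | no i+2≰k = trans (cong (λ x → K * x * cβ) (gradCoeff-out-of-range k m i i+2≰k))
                     (solve 2 (λ a b → a :* con 0ℚ :* b := con 0ℚ) refl K cβ)
    where cβ = gradCoeff (toℕ (π ⟨$⟩ʳ m)) (k ∸ pos (π ⟨$⟩ʳ m)) j
  ... | yes i+2≤k = trans
    (cong (K * cα *_) (gradCoeff-out-of-range k (π ⟨$⟩ʳ m) j (λ j+2≤k → out-of-range (i+2≤k , j+2≤k))))
    (ℚP.*-zeroʳ (K * cα))
    where cα = gradCoeff (toℕ m) (k ∸ pos m) i

lemma6 : (k : ℕ) (π : Permutation′ k) (i j : ℕ) →
    ((i + 2 ≤ k × j + 2 ≤ k) →
      coeff i j (gradPoly k π)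
        ≡ (ℕ→ℚ (k !) * neg1^ (i + j) * invFact i * invFact j
            * invFact (k ∸ (i + 2)) * invFact (k ∸ (j + 2)))
          * bilin k (bvec k (i + 2)) (permMatrix k π) (bvec k (j + 2)))
    × (¬ (i + 2 ≤ k × j + 2 ≤ k) → coeff i j (gradPoly k π) ≡ 0ℚ)
lemma6 k π i j = in-range , gradPoly-coeff-out-of-range k π i j
  where
  open ≡-Reasoning
  K = ℕ→ℚ (k !)
  u = bvec k (i + 2)
  v = bvec k (j + 2)
  cᵢ = neg1^ i * invFact i * invFact (k ∸ (i + 2))
  cⱼ = neg1^ j * invFact j * invFact (k ∸ (j + 2))
  W = K * neg1^ (i + j) * invFact i * invFact j * invFact (k ∸ (i + 2)) * invFact (k ∸ (j + 2))
  regroup : ∀ x y → K * (cᵢ * x) * (cⱼ * y) ≡ W * (x * y)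
  regroup x y = trans
    (solve 9 (λ K si Ii Ei x sj Ij Ej y → K :* (si :* Ii :* Ei :* x) :* (sj :* Ij :* Ej :* y)
                := K :* (si :* sj) :* Ii :* Ij :* Ei :* Ej :* (x :* y)) refl
       K (neg1^ i) (invFact i) (invFact (k ∸ (i + 2))) x (neg1^ j) (invFact j) (invFact (k ∸ (j + 2))) y)
    (cong (λ s → K * s * invFact i * invFact j * invFact (k ∸ (i + 2)) * invFact (k ∸ (j + 2)) * (x * y))
          (sym (neg1^-+ i j)))
  in-range : i + 2 ≤ k × j + 2 ≤ k → coeff i j (gradPoly k π) ≡ W * bilin k u (permMatrix k π) v
  in-range (i+2≤k , j+2≤k) = begin
    coeff i j (gradPoly k π)
      ≡⟨ gradPoly-coeff k π i j ⟩
    sumFin k (λ m → K * gradCoeff (toℕ m) (k ∸ pos m) i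
                      * gradCoeff (toℕ (π ⟨$⟩ʳ m)) (k ∸ pos (π ⟨$⟩ʳ m)) j)
      ≡⟨ sumFin-cong k (λ m → cong₂ (λ x y → K * x * y)
           (gradCoeff-in-range k m i i+2≤k) (gradCoeff-in-range k (π ⟨$⟩ʳ m) j j+2≤k)) ⟩
    sumFin k (λ m → K * (cᵢ * u m) * (cⱼ * v (π ⟨$⟩ʳ m)))
      ≡⟨ sumFin-cong k (λ m → regroup (u m) (v (π ⟨$⟩ʳ m))) ⟩
    sumFin k (λ m → W * (u m * v (π ⟨$⟩ʳ m)))
      ≡⟨ sumFin-*ˡ k W (λ m → u m * v (π ⟨$⟩ʳ m)) ⟩
    W * sumFin k (λ m → u m * v (π ⟨$⟩ʳ m))
      ≡⟨ cong (W *_) (sym (bilin-permMatrix k π u v)) ⟩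
    W * bilin k u (permMatrix k π) v ∎
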